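{- Let $\beta\ge1$, $m$ be positive integers and $\mathcal{C}$ a color space; let $l_0=4e\beta^2(4\log \beta+\log\log |\mathcal{C}|+\log\log m+8)$, $\tau=\lceil 8\log\beta + 2\log\log|\mathcal{C}| + 2\log\log m\rceil+14$, $\tau'=2^{\tau-\lceil\log(2e\beta^2)\rceil}$, $k'=\beta\tau'$, let $k$ be an integer with $\tau\le k\le\beta\tau$, and let $d_2\ge 0$ be any integer. Let $X,Y\subseteq\mathcal{C}$ with $|X|=|Y|=l_0$ and let $d_1=\binom{k}{\tau}\binom{l_0-\tau}{k-\tau}$. Then: (1) for any $C\in L_1(X)$, at most $d_1$ sets in $L_1(Y)$ $\tau$-conflict with $C$; (2) for any $K\in L_2(X)$, at most $d_2$ elements of $L_2(Y)$ $(\tau',\tau)$-conflict with $K$.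
   Context: Logarithms are base 2. $\binom{S}{j}$ denotes the set of $j$-element subsets of $S$. Two sets $C,C'\subseteq\mathcal{C}$ $\tau$-conflict if $|C\cap C'|\ge\tau$. Two collections $K,K'$ of subsets of $\mathcal{C}$ $(\tau',\tau)$-conflict if there are sequences $C_1,\dots,C_{\tau'}\in K$ and $C'_1,\dots,C'_{\tau'}\in K'$, at least one of which consists of $\tau'$ distinct elements, such that $C_i$ and $C'_i$ $\tau$-conflict for every $i$. For $S\subseteq\mathcal{C}$ with $|S|=l_0$: $L_1(S)=\binom{S}{k}$; $\bar L_2(S)=\binom{L_1(S)}{k'}$; a collection $K\in\bar L_2(S)$ is good if there are fewer than $d_2$ collections $K'\in\bar L_2(S)$ such that $K$ and $K'$ $(\tau',\tau)$-conflict; and $L_2(S)=\{K\in\bar L_2(S): K \text{ is good}\}$. -}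

module Defs where

open import Data.Nat using (ℕ; _≤_; _<_; _*_; _∸_; _^_)
open import Data.Nat.Combinatorics using (_C_)
open import Data.Fin using (Fin)
open import Data.Fin.Subset using (Subset; _⊆_; _∩_; ∣_∣)
open import Data.List using (List; length)
open import Data.List.Membership.Propositional using (_∈_)
open import Data.List.Relation.Unary.All using (All)
open import Data.List.Relation.Unary.AllPairs using (AllPairs)
open import Data.List.Relation.Unary.Unique.Propositional using (Unique)
open import Data.Product using (_×_; Σ-syntax)
open import Data.Sum using (_⊎_)
open import Function.Definitions using (Injective)
open import Function.Bundles using (_⇔_)
open import Relation.Binary.PropositionalEquality using (_≡_)
open import Relation.Nullary using (¬_)

-- The colour space 𝒞 is the finite set Fin n; subsets of 𝒞 are Subset n.

-- A finite collection of subsets of 𝒞 is represented by a list of its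
-- elements; two such lists denote the same collection iff they have the
-- same members.
Coll : ℕ → Set
Coll n = List (Subset n)

_≋_ : ∀ {n} → Coll n → Coll n → Set
K ≋ K' = ∀ C → (C ∈ K) ⇔ (C ∈ K')

-- "There are at most d elements of type A satisfying P, counted up to the
-- equivalence R": every list of pairwise R-distinct elements satisfying P
-- has length ≤ d.
AtMost : {A : Set} → (A → A → Set) → (A → Set) → ℕ → Set
AtMost {A} R P d =
  (xs : List A) → AllPairs (λ a b → ¬ R a b) xs → All P xs → length xs ≤ d

FewerThan : {A : Set} → (A → A → Set) → (A → Set) → ℕ → Set
FewerThan {A} R P d =
  (xs : List A) → AllPairs (λ a b → ¬ R a b) xs → All P xs → length xs < d

τConflict : ∀ {n} → ℕ → Subset n → Subset n → Set
τConflict τ C C' = τ ≤ ∣ C ∩ C' ∣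

Conflict2 : ∀ {n} → ℕ → ℕ → Coll n → Coll n → Set
Conflict2 τ' τ K K' =
  Σ[ f ∈ (Fin τ' → Subset _) ] Σ[ g ∈ (Fin τ' → Subset _) ]
    ((∀ i → f i ∈ K) × (∀ i → g i ∈ K')
     × (Injective _≡_ _≡_ f ⊎ Injective _≡_ _≡_ g)
     × (∀ i → τConflict τ (f i) (g i)))

L1 : ∀ {n} → ℕ → Subset n → Subset n → Set
L1 k S C = (C ⊆ S) × (∣ C ∣ ≡ k)

L2bar : ∀ {n} → ℕ → ℕ → Subset n → Coll n → Set
L2bar k k' S K = All (L1 k S) K × Unique K × (length K ≡ k')

Good : ∀ {n} → ℕ → ℕ → ℕ → ℕ → ℕ → Subset n → Coll n → Set
Good k k' τ' τ d₂ S K =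
  FewerThan _≋_ (λ K' → L2bar k k' S K' × Conflict2 τ' τ K K') d₂

L2 : ∀ {n} → ℕ → ℕ → ℕ → ℕ → ℕ → Subset n → Coll n → Set
L2 k k' τ' τ d₂ S K = L2bar k k' S K × Good k k' τ' τ d₂ S K

d1 : ℕ → ℕ → ℕ → ℕ
d1 l₀ k τ = (k C τ) * ((l₀ ∸ τ) C (k ∸ τ))

-- (1) Induct on the colour space, splitting the k-subsets A of Y that τ-conflict with C
-- according to whether they contain the first colour: Pascal's rule in one of the two
-- factors of binom(|C ∩ Y|, τ) · binom(|Y| - τ, k - τ) absorbs the two halves, and
-- |C ∩ Y| ≤ |C| = k turns this bound into d₁.
-- (2) Since |X| = |Y|, there is an injection from subsets of Y to subsets of X which
-- keeps the part inside X and sends the part in Y ∖ X, order-preservingly, into X ∖ Y.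
-- It preserves sizes and only enlarges intersections with subsets of X, so it maps the
-- members of L₂(Y) conflicting with K to pairwise distinct members of L̄₂(X) conflicting
-- with K; as K is good, there are fewer than d₂ of those.
module Submission where

open import Defs
open import Data.Bool using (Bool; true; false)
open import Data.Empty using (⊥-elim)
open import Data.Fin using (zero)
open import Data.Fin.Subset using (Subset; _⊆_; _∩_; _∪_; ∁; ∣_∣; ⊤; ⊥; Empty)
open import Data.Fin.Subset.Properties
  using ( drop-∷-⊆; drop-∷-Empty; Empty-unique; ⊆-refl; ⊆-trans; ⊆-antisym; p⊆q⇒∣p∣≤∣q∣
        ; p∩q⊆p; p∩q⊆q; x∈p∩q⁺; x∈p∩q⁻; ∣p∩q∣≤∣p∣; ∣p∩q∣≤∣q∣; p⊆p∪q; x∈p∪q⁻; x∈∁p⇒x∉p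
        ; ∩-assoc; ∩-comm; ∩-identityˡ; ∩-distribˡ-∪; ∩-distribʳ-∪
        ; ∪-comm; ∪-identityʳ; ∪-inverseʳ )
open import Data.List using (List; []; _∷_; length; map)
open import Data.List.Properties using (length-map)
open import Data.List.Membership.Propositional using (_∈_)
open import Data.List.Membership.Propositional.Properties using (∈-map⁺; ∈-map⁻)
open import Data.List.Relation.Unary.All as All using (All; []; _∷_)
open import Data.List.Relation.Unary.All.Properties as All using ()
open import Data.List.Relation.Unary.AllPairs using (AllPairs; []; _∷_)
open import Data.Nat using (ℕ; zero; suc; _≤_; _+_; _*_; _∸_; _^_; z≤n; s≤s; _≤?_; _≤′_; ≤′-refl; ≤′-step)
open import Data.Nat.Properties
  using ( ≤-refl; ≤-reflexive; ≤-trans; ≤-<-trans; <⇒≤; ≰⇒>; ≤⇒≤′; n≤1+n; m≤n+m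
        ; suc-injective; +-comm; +-suc; +-identityʳ; +-cancelˡ-≡; +-mono-≤; +-∸-assoc
        ; *-mono-≤; *-monoʳ-≤; *-distribˡ-+; *-distribʳ-+; ∸-monoˡ-≤; ∸-monoʳ-≤
        ; module ≤-Reasoning )
open import Data.Product using (_×_; _,_; proj₁)
open import Data.Sum using (_⊎_; inj₁; inj₂)
open import Data.Vec using ([]; _∷_; here; there)
open import Function using (id; _∘_)
open import Function.Bundles using (mk⇔; Equivalence)
open import Function.Definitions using (Injective)
open import Relation.Nullary using (¬_; yes; no)
open import Relation.Binary.PropositionalEquality
  using (_≡_; refl; sym; trans; cong; cong₂; subst; module ≡-Reasoning)
open import Relation.Binary.PropositionalEquality.Properties using (subst-sym-subst)

private variable
  A B : Set
  P Q : A → Set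
  R S : A → A → Set
  d d' : ℕ

fewerThan⇒atMost : FewerThan R P d → AtMost R P d
fewerThan⇒atMost fewer xs distinct ps = <⇒≤ (fewer xs distinct ps)

atMost-mono : d ≤ d' → AtMost R P d → AtMost R P d'
atMost-mono d≤d' atMost xs distinct ps = ≤-trans (atMost xs distinct ps) d≤d'

atMost-none : (∀ {x} → ¬ P x) → AtMost R P 0
atMost-none ¬P []      _ _        = z≤n
atMost-none ¬P (_ ∷ _) _ (p ∷ _) = ⊥-elim (¬P p)

map-distinct : (f : A → B) → (∀ {x y} → P x → P y → S (f x) (f y) → R x y) →
               ∀ {xs} → All P xs → AllPairs (λ a b → ¬ R a b) xs →
               AllPairs (λ a b → ¬ S a b) (map f xs)
map-distinct f reflects []       []         = []
map-distinct f reflects (p ∷ ps) (¬Rs ∷ rs) =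
  All.map⁺ (All.zipWith (λ (q , ¬R) S-fxfy → ¬R (reflects p q S-fxfy)) (ps , ¬Rs))
  ∷ map-distinct f reflects ps rs

atMost-pullback : (f : A → B) → (∀ {x} → P x → Q (f x)) →
                  (∀ {x y} → P x → P y → S (f x) (f y) → R x y) →
                  AtMost S Q d → AtMost R P d
atMost-pullback f P⇒Q reflects atMost xs distinct ps =
  subst (_≤ _) (length-map f xs)
        (atMost (map f xs) (map-distinct f reflects ps distinct) (All.map⁺ (All.map P⇒Q ps)))

atMost-weaken : (∀ {x} → P x → Q x) → AtMost R Q d → AtMost R P d
atMost-weaken P⇒Q = atMost-pullback id P⇒Q (λ _ _ r → r)

map-≋⁻ : ∀ {n} {P : Subset n → Set} (f : Subset n → Subset n) →
         (∀ {A B} → P A → P B → f A ≡ f B → A ≡ B) →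
         ∀ {K₁ K₂} → All P K₁ → All P K₂ → map f K₁ ≋ map f K₂ → K₁ ≋ K₂
map-≋⁻ {P = P} f injective P-K₁ P-K₂ fK₁≋fK₂ C₀ =
  mk⇔ (included P-K₁ P-K₂ (Equivalence.to (fK₁≋fK₂ _))) (included P-K₂ P-K₁ (Equivalence.from (fK₁≋fK₂ _)))
  where
  included : ∀ {K₁ K₂} → All P K₁ → All P K₂ →
             (∀ {D} → D ∈ map f K₁ → D ∈ map f K₂) → C₀ ∈ K₁ → C₀ ∈ K₂
  included P-K₁ P-K₂ fK₁⊆fK₂ C₀∈K₁ with ∈-map⁻ f (fK₁⊆fK₂ (∈-map⁺ f C₀∈K₁))
  ... | D , D∈K₂ , fC₀≡fD =
    subst (_∈ _) (sym (injective (All.lookup P-K₁ C₀∈K₁) (All.lookup P-K₂ D∈K₂) fC₀≡fD)) D∈K₂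

module _ where

  open import Data.Nat.Combinatorics using (_C_; nCk+nC[k+1]≡[n+1]C[k+1]; k>n⇒nCk≡0)

  C-step : ∀ m j → m C j ≤ suc m C j
  C-step m zero    = ≤-refl
  C-step m (suc j) = subst (m C suc j ≤_) (nCk+nC[k+1]≡[n+1]C[k+1] m j) (m≤n+m _ _)

  C-monoˡ-≤ : ∀ {m m'} j → m ≤ m' → m C j ≤ m' C j
  C-monoˡ-≤ j m≤m' = mono (≤⇒≤′ m≤m')
    where
    mono : ∀ {m m'} → m ≤′ m' → m C j ≤ m' C j
    mono ≤′-refl     = ≤-refl
    mono (≤′-step p) = ≤-trans (mono p) (C-step _ j)

  conflictBound : ℕ → ℕ → ℕ → ℕ → ℕ
  conflictBound a l k τ = (a C τ) * ((l ∸ τ) C (k ∸ τ))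

  conflictBound-mono : ∀ {a a' l l'} k τ → a ≤ a' → l ≤ l' →
                       conflictBound a l k τ ≤ conflictBound a' l' k τ
  conflictBound-mono k τ a≤a' l≤l' = *-mono-≤ (C-monoˡ-≤ τ a≤a') (C-monoˡ-≤ (k ∸ τ) (∸-monoˡ-≤ τ l≤l'))

  conflictBound-pascalʳ : ∀ {a l} k τ → a ≤ l → τ ≤ k →
    conflictBound a l (suc k) τ + conflictBound a l k τ ≡ conflictBound a (suc l) (suc k) τ
  conflictBound-pascalʳ {a} {l} k τ a≤l τ≤k with τ ≤? l
  ... | yes τ≤l = begin
    (a C τ) * ((l ∸ τ) C (suc k ∸ τ)) + (a C τ) * ((l ∸ τ) C (k ∸ τ))
      ≡⟨ sym (*-distribˡ-+ (a C τ) _ _) ⟩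
    (a C τ) * ((l ∸ τ) C (suc k ∸ τ) + (l ∸ τ) C (k ∸ τ))
      ≡⟨ cong ((a C τ) *_) (trans (+-comm ((l ∸ τ) C (suc k ∸ τ)) _) pascal) ⟩
    (a C τ) * ((suc l ∸ τ) C (suc k ∸ τ)) ∎
    where
    open ≡-Reasoning
    pascal : (l ∸ τ) C (k ∸ τ) + (l ∸ τ) C (suc k ∸ τ) ≡ (suc l ∸ τ) C (suc k ∸ τ)
    pascal rewrite +-∸-assoc 1 τ≤l | +-∸-assoc 1 τ≤k = nCk+nC[k+1]≡[n+1]C[k+1] (l ∸ τ) (k ∸ τ)
  ... | no τ≰l rewrite k>n⇒nCk≡0 (≤-<-trans a≤l (≰⇒> τ≰l)) = refl

  conflictBound-pascalˡ : ∀ a l k τ →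
    conflictBound a l (suc k) (suc τ) + conflictBound a l k τ ≤ conflictBound (suc a) (suc l) (suc k) (suc τ)
  conflictBound-pascalˡ a l k τ = begin
    (a C suc τ) * ((l ∸ suc τ) C (k ∸ τ)) + (a C τ) * M
      ≤⟨ +-mono-≤ (*-monoʳ-≤ (a C suc τ) (C-monoˡ-≤ (k ∸ τ) (∸-monoʳ-≤ l (n≤1+n τ)))) ≤-refl ⟩
    (a C suc τ) * M + (a C τ) * M
      ≡⟨ +-comm ((a C suc τ) * M) _ ⟩
    (a C τ) * M + (a C suc τ) * M
      ≡⟨ sym (*-distribʳ-+ M (a C τ) _) ⟩
    (a C τ + a C suc τ) * M
      ≡⟨ cong (_* M) (nCk+nC[k+1]≡[n+1]C[k+1] a τ) ⟩
    (suc a C suc τ) * M ∎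
    where
    open ≤-Reasoning
    M = (l ∸ τ) C (k ∸ τ)

  tailsWithHead : ∀ {n} → Bool → List (Subset (suc n)) → List (Subset n)
  tailsWithHead b     []                  = []
  tailsWithHead false ((false ∷ v) ∷ xs) = v ∷ tailsWithHead false xs
  tailsWithHead false ((true  ∷ _) ∷ xs) = tailsWithHead false xs
  tailsWithHead true  ((false ∷ _) ∷ xs) = tailsWithHead true xs
  tailsWithHead true  ((true  ∷ v) ∷ xs) = v ∷ tailsWithHead true xs

  length-tailsWithHead : ∀ {n} (xs : List (Subset (suc n))) →
    length xs ≡ length (tailsWithHead false xs) + length (tailsWithHead true xs)
  length-tailsWithHead []                 = refl
  length-tailsWithHead ((false ∷ _) ∷ xs) = cong suc (length-tailsWithHead xs)
  length-tailsWithHead ((true  ∷ _) ∷ xs) = trans (cong suc (length-tailsWithHead xs)) (sym (+-suc _ _))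

  All-tailsWithHead : ∀ {n} {P : Subset (suc n) → Set} b {xs} →
                      All P xs → All (λ v → P (b ∷ v)) (tailsWithHead b xs)
  All-tailsWithHead b     []                               = []
  All-tailsWithHead false {(false ∷ _) ∷ _} (p ∷ ps) = p ∷ All-tailsWithHead false ps
  All-tailsWithHead false {(true  ∷ _) ∷ _} (_ ∷ ps) = All-tailsWithHead false ps
  All-tailsWithHead true  {(false ∷ _) ∷ _} (_ ∷ ps) = All-tailsWithHead true ps
  All-tailsWithHead true  {(true  ∷ _) ∷ _} (p ∷ ps) = p ∷ All-tailsWithHead true ps

  distinct-tailsWithHead : ∀ {n} b {xs : List (Subset (suc n))} →
    AllPairs (λ u v → ¬ u ≡ v) xs → AllPairs (λ u v → ¬ u ≡ v) (tailsWithHead b xs)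
  distinct-tailsWithHead b {[]} [] = []
  distinct-tailsWithHead false {(false ∷ _) ∷ _} (≢s ∷ d) =
    All.map (λ ≢ v≡w → ≢ (cong (false ∷_) v≡w)) (All-tailsWithHead false ≢s) ∷ distinct-tailsWithHead false d
  distinct-tailsWithHead false {(true ∷ _) ∷ _} (_ ∷ d) = distinct-tailsWithHead false d
  distinct-tailsWithHead true {(false ∷ _) ∷ _} (_ ∷ d) = distinct-tailsWithHead true d
  distinct-tailsWithHead true {(true ∷ _) ∷ _} (≢s ∷ d) =
    All.map (λ ≢ v≡w → ≢ (cong (true ∷_) v≡w)) (All-tailsWithHead true ≢s) ∷ distinct-tailsWithHead true d

  atMost-split : ∀ {n} {P : Subset (suc n) → Set} {d₀ d₁} →
                 AtMost _≡_ (λ v → P (false ∷ v)) d₀ → AtMost _≡_ (λ v → P (true ∷ v)) d₁ →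
                 d₀ + d₁ ≤ d → AtMost _≡_ P d
  atMost-split atMost₀ atMost₁ d₀+d₁≤d xs distinct ps =
    subst (_≤ _) (sym (length-tailsWithHead xs))
          (≤-trans (+-mono-≤ (atMost₀ _ (distinct-tailsWithHead false distinct) (All-tailsWithHead false ps))
                             (atMost₁ _ (distinct-tailsWithHead true distinct) (All-tailsWithHead true ps)))
                   d₀+d₁≤d)

  atMost-false∷ : ∀ {n} {P : Subset (suc n) → Set} →
                  (∀ {v} → ¬ P (true ∷ v)) → AtMost _≡_ (λ v → P (false ∷ v)) d → AtMost _≡_ P d
  atMost-false∷ ¬P atMost₀ = atMost-split atMost₀ (atMost-none ¬P) (≤-reflexive (+-identityʳ _))

  -- A ∩ C₀ rather than C₀ ∩ A: the first bit of A ∩ C₀ then reduces once the first bit of A is known.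
  Conflicting₁ : ∀ {n} → ℕ → ℕ → Subset n → Subset n → Subset n → Set
  Conflicting₁ k τ Y C₀ A = L1 k Y A × τ ≤ ∣ A ∩ C₀ ∣

  conflicting₁-bound₀ : ∀ k τ → AtMost _≡_ (Conflicting₁ k τ [] []) (conflictBound 0 0 k τ)
  conflicting₁-bound₀ k τ []           _                _                              = z≤n
  conflicting₁-bound₀ _ _ ([] ∷ [])    _                (((_ , refl) , z≤n) ∷ []) = ≤-refl
  conflicting₁-bound₀ k τ ([] ∷ [] ∷ _) ((≢ ∷ _) ∷ _) _                              = ⊥-elim (≢ refl)

  true∷⊈false∷ : ∀ {n} {v Y : Subset n} → ¬ (true ∷ v ⊆ false ∷ Y)
  true∷⊈false∷ v⊆Y with v⊆Y here
  ... | ()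

  atMost-drop-false : ∀ {n k τ y} {Y C₀ : Subset n} →
    AtMost _≡_ (Conflicting₁ k τ Y C₀) d → AtMost _≡_ (λ v → L1 k (y ∷ Y) (false ∷ v) × τ ≤ ∣ v ∩ C₀ ∣) d
  atMost-drop-false = atMost-weaken λ ((v⊆Y , ∣v∣≡k) , conflict) → (drop-∷-⊆ v⊆Y , ∣v∣≡k) , conflict

  L1-drop-true : ∀ {n k y} {Y v : Subset n} → L1 (suc k) (y ∷ Y) (true ∷ v) → L1 k Y v
  L1-drop-true (v⊆Y , ∣v∣≡k) = drop-∷-⊆ v⊆Y , suc-injective ∣v∣≡k

  conflicting₁-bound : ∀ {n} k τ (Y C₀ : Subset n) →
                       AtMost _≡_ (Conflicting₁ k τ Y C₀) (conflictBound ∣ Y ∩ C₀ ∣ ∣ Y ∣ k τ)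
  conflicting₁-bound k τ [] [] = conflicting₁-bound₀ k τ
  conflicting₁-bound k τ (false ∷ Y) (c ∷ C₀) =
    atMost-false∷ (λ ((v⊆Y , _) , _) → true∷⊈false∷ v⊆Y)
                  (atMost-drop-false (conflicting₁-bound k τ Y C₀))
  conflicting₁-bound zero τ (true ∷ Y) (false ∷ C₀) =
    atMost-false∷ (λ { ((_ , ()) , _) })
                  (atMost-mono (conflictBound-mono 0 τ ≤-refl (n≤1+n _))
                               (atMost-drop-false (conflicting₁-bound 0 τ Y C₀)))
  conflicting₁-bound (suc k) τ (true ∷ Y) (false ∷ C₀) with τ ≤? k
  ... | no τ≰k =
    atMost-false∷ (λ {v} ((_ , ∣v∣≡k) , conflict) →
                    τ≰k (≤-trans conflict (≤-trans (∣p∩q∣≤∣p∣ v C₀) (≤-reflexive (suc-injective ∣v∣≡k)))))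
                  (atMost-mono (conflictBound-mono (suc k) τ ≤-refl (n≤1+n _))
                               (atMost-drop-false (conflicting₁-bound (suc k) τ Y C₀)))
  ... | yes τ≤k =
    atMost-split (atMost-drop-false (conflicting₁-bound (suc k) τ Y C₀))
                 (atMost-weaken (λ (l1 , conflict) → L1-drop-true l1 , conflict) (conflicting₁-bound k τ Y C₀))
                 (≤-reflexive (conflictBound-pascalʳ k τ (∣p∩q∣≤∣p∣ Y C₀) τ≤k))
  conflicting₁-bound zero τ (true ∷ Y) (true ∷ C₀) =
    atMost-false∷ (λ { ((_ , ()) , _) })
                  (atMost-mono (conflictBound-mono 0 τ (n≤1+n _) (n≤1+n _))
                               (atMost-drop-false (conflicting₁-bound 0 τ Y C₀)))
  conflicting₁-bound (suc k) zero (true ∷ Y) (true ∷ C₀) =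
    atMost-split (atMost-drop-false (conflicting₁-bound (suc k) 0 Y C₀))
                 (atMost-weaken (λ (l1 , _) → L1-drop-true l1 , z≤n) (conflicting₁-bound k 0 Y C₀))
                 (≤-reflexive (conflictBound-pascalʳ k 0 (∣p∩q∣≤∣p∣ Y C₀) z≤n))
  conflicting₁-bound (suc k) (suc τ) (true ∷ Y) (true ∷ C₀) =
    atMost-split (atMost-drop-false (conflicting₁-bound (suc k) (suc τ) Y C₀))
                 (atMost-weaken (λ { (l1 , s≤s conflict) → L1-drop-true l1 , conflict }) (conflicting₁-bound k τ Y C₀))
                 (conflictBound-pascalˡ ∣ Y ∩ C₀ ∣ ∣ Y ∣ k τ)

  L1-conflicts-bound : ∀ {n k l₀} τ (Y C₀ : Subset n) → ∣ C₀ ∣ ≡ k → ∣ Y ∣ ≡ l₀ →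
                       AtMost _≡_ (λ A → L1 k Y A × τConflict τ C₀ A) (d1 l₀ k τ)
  L1-conflicts-bound {k = k} τ Y C₀ ∣C₀∣≡k ∣Y∣≡l₀ =
    atMost-mono (conflictBound-mono k τ (≤-trans (∣p∩q∣≤∣q∣ Y C₀) (≤-reflexive ∣C₀∣≡k)) (≤-reflexive ∣Y∣≡l₀))
      (atMost-weaken (λ {A} (A∈L1 , conflict) → A∈L1 , subst (τ ≤_) (cong ∣_∣ (∩-comm C₀ A)) conflict)
        (conflicting₁-bound k τ Y C₀))

p⊆q⇒q∩p≡p : ∀ {n} {p q : Subset n} → p ⊆ q → q ∩ p ≡ p
p⊆q⇒q∩p≡p {p = p} {q} p⊆q = ⊆-antisym (p∩q⊆q q p) (λ x∈p → x∈p∩q⁺ (p⊆q x∈p , x∈p))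

⊆-∁-disjoint : ∀ {n} {p q r : Subset n} → p ⊆ q → r ⊆ ∁ q → Empty (p ∩ r)
⊆-∁-disjoint {p = p} {r = r} p⊆q r⊆∁q (x , x∈p∩r) =
  let x∈p , x∈r = x∈p∩q⁻ p r x∈p∩r in x∈∁p⇒x∉p (r⊆∁q x∈r) (p⊆q x∈p)

∪-⊆ : ∀ {n} {p q r : Subset n} → p ⊆ r → q ⊆ r → p ∪ q ⊆ r
∪-⊆ {p = p} {q} p⊆r q⊆r x∈p∪q with x∈p∪q⁻ p q x∈p∪q
... | inj₁ x∈p = p⊆r x∈p
... | inj₂ x∈q = q⊆r x∈q

p⊆r⇒r∩[p∪q]≡p : ∀ {n} {p q r : Subset n} → p ⊆ r → Empty (r ∩ q) → r ∩ (p ∪ q) ≡ p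
p⊆r⇒r∩[p∪q]≡p {p = p} {q} {r} p⊆r disjoint = begin
  r ∩ (p ∪ q)           ≡⟨ ∩-distribˡ-∪ r p q ⟩
  (r ∩ p) ∪ (r ∩ q)     ≡⟨ cong₂ _∪_ (p⊆q⇒q∩p≡p p⊆r) (Empty-unique disjoint) ⟩
  p ∪ ⊥                 ≡⟨ ∪-identityʳ p ⟩
  p                     ∎
  where open ≡-Reasoning

[q∩p]∪[∁q∩p]≡p : ∀ {n} (p q : Subset n) → (q ∩ p) ∪ (∁ q ∩ p) ≡ p
[q∩p]∪[∁q∩p]≡p p q = begin
  (q ∩ p) ∪ (∁ q ∩ p)   ≡⟨ ∩-distribʳ-∪ p q (∁ q) ⟨
  (q ∪ ∁ q) ∩ p         ≡⟨ cong (_∩ p) (∪-inverseʳ q) ⟩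
  ⊤ ∩ p                 ≡⟨ ∩-identityˡ p ⟩
  p                     ∎
  where open ≡-Reasoning

∣∪∣-disjoint : ∀ {n} (p q : Subset n) → Empty (p ∩ q) → ∣ p ∪ q ∣ ≡ ∣ p ∣ + ∣ q ∣
∣∪∣-disjoint []          []          _        = refl
∣∪∣-disjoint (true ∷ p)  (true ∷ q)  disjoint = ⊥-elim (disjoint (zero , here))
∣∪∣-disjoint (true ∷ p)  (false ∷ q) disjoint = cong suc (∣∪∣-disjoint p q (drop-∷-Empty disjoint))
∣∪∣-disjoint (false ∷ p) (true ∷ q)  disjoint =
  trans (cong suc (∣∪∣-disjoint p q (drop-∷-Empty disjoint))) (sym (+-suc _ _))
∣∪∣-disjoint (false ∷ p) (false ∷ q) disjoint = ∣∪∣-disjoint p q (drop-∷-Empty disjoint)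

∣p∣≡∣q∩p∣+∣∁q∩p∣ : ∀ {n} (p q : Subset n) → ∣ p ∣ ≡ ∣ q ∩ p ∣ + ∣ ∁ q ∩ p ∣
∣p∣≡∣q∩p∣+∣∁q∩p∣ p q = begin
  ∣ p ∣                         ≡⟨ cong ∣_∣ ([q∩p]∪[∁q∩p]≡p p q) ⟨
  ∣ (q ∩ p) ∪ (∁ q ∩ p) ∣       ≡⟨ ∣∪∣-disjoint _ _ (⊆-∁-disjoint (p∩q⊆p q p) (p∩q⊆p (∁ q) p)) ⟩
  ∣ q ∩ p ∣ + ∣ ∁ q ∩ p ∣       ∎
  where open ≡-Reasoning

∣∁p∩q∣≡∣∁q∩p∣ : ∀ {n} (p q : Subset n) → ∣ p ∣ ≡ ∣ q ∣ → ∣ ∁ p ∩ q ∣ ≡ ∣ ∁ q ∩ p ∣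
∣∁p∩q∣≡∣∁q∩p∣ p q ∣p∣≡∣q∣ = +-cancelˡ-≡ ∣ p ∩ q ∣ _ _ (begin
  ∣ p ∩ q ∣ + ∣ ∁ p ∩ q ∣   ≡⟨ ∣p∣≡∣q∩p∣+∣∁q∩p∣ q p ⟨
  ∣ q ∣                     ≡⟨ ∣p∣≡∣q∣ ⟨
  ∣ p ∣                     ≡⟨ ∣p∣≡∣q∩p∣+∣∁q∩p∣ p q ⟩
  ∣ q ∩ p ∣ + ∣ ∁ q ∩ p ∣   ≡⟨ cong (_+ ∣ ∁ q ∩ p ∣) (cong ∣_∣ (∩-comm q p)) ⟩
  ∣ p ∩ q ∣ + ∣ ∁ q ∩ p ∣   ∎)
  where open ≡-Reasoning

bitsAt : ∀ {n} (s : Subset n) → Subset n → Subset ∣ s ∣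
bitsAt []          []      = []
bitsAt (false ∷ s) (_ ∷ A) = bitsAt s A
bitsAt (true ∷ s)  (a ∷ A) = a ∷ bitsAt s A

placeAt : ∀ {n} (s : Subset n) → Subset ∣ s ∣ → Subset n
placeAt []          []      = []
placeAt (false ∷ s) v       = false ∷ placeAt s v
placeAt (true ∷ s)  (b ∷ v) = b ∷ placeAt s v

placeAt-⊆ : ∀ {n} (s : Subset n) v → placeAt s v ⊆ s
placeAt-⊆ (false ∷ s) v       (there x∈) = there (placeAt-⊆ s v x∈)
placeAt-⊆ (true ∷ s)  (b ∷ v) here       = here
placeAt-⊆ (true ∷ s)  (b ∷ v) (there x∈) = there (placeAt-⊆ s v x∈)

bitsAt-placeAt : ∀ {n} (s : Subset n) v → bitsAt s (placeAt s v) ≡ v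
bitsAt-placeAt []          []      = refl
bitsAt-placeAt (false ∷ s) v       = bitsAt-placeAt s v
bitsAt-placeAt (true ∷ s)  (b ∷ v) = cong (b ∷_) (bitsAt-placeAt s v)

placeAt-bitsAt : ∀ {n} (s A : Subset n) → placeAt s (bitsAt s A) ≡ s ∩ A
placeAt-bitsAt []          []      = refl
placeAt-bitsAt (false ∷ s) (_ ∷ A) = cong (false ∷_) (placeAt-bitsAt s A)
placeAt-bitsAt (true ∷ s)  (a ∷ A) = cong (a ∷_) (placeAt-bitsAt s A)

∣placeAt∣ : ∀ {n} (s : Subset n) v → ∣ placeAt s v ∣ ≡ ∣ v ∣
∣placeAt∣ []          []          = refl
∣placeAt∣ (false ∷ s) v           = ∣placeAt∣ s v
∣placeAt∣ (true ∷ s)  (false ∷ v) = ∣placeAt∣ s v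
∣placeAt∣ (true ∷ s)  (true ∷ v)  = cong suc (∣placeAt∣ s v)

bitsAt-cong : ∀ {n} (s : Subset n) {A B} → s ∩ A ≡ s ∩ B → bitsAt s A ≡ bitsAt s B
bitsAt-cong s {A} {B} s∩A≡s∩B = begin
  bitsAt s A                         ≡⟨ bitsAt-placeAt s _ ⟨
  bitsAt s (placeAt s (bitsAt s A))  ≡⟨ cong (bitsAt s) (placeAt-bitsAt s A) ⟩
  bitsAt s (s ∩ A)                   ≡⟨ cong (bitsAt s) s∩A≡s∩B ⟩
  bitsAt s (s ∩ B)                   ≡⟨ cong (bitsAt s) (placeAt-bitsAt s B) ⟨
  bitsAt s (placeAt s (bitsAt s B))  ≡⟨ bitsAt-placeAt s _ ⟩
  bitsAt s B                         ∎
  where open ≡-Reasoning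

∣subst∣ : ∀ {m m'} (m≡m' : m ≡ m') (v : Subset m) → ∣ subst Subset m≡m' v ∣ ≡ ∣ v ∣
∣subst∣ refl v = refl

transfer : ∀ {n} (s t : Subset n) → ∣ s ∣ ≡ ∣ t ∣ → Subset n → Subset n
transfer s t ∣s∣≡∣t∣ A = placeAt t (subst Subset ∣s∣≡∣t∣ (bitsAt s A))

module _ {n} (s t : Subset n) (∣s∣≡∣t∣ : ∣ s ∣ ≡ ∣ t ∣) where

  transfer-⊆ : ∀ A → transfer s t ∣s∣≡∣t∣ A ⊆ t
  transfer-⊆ A = placeAt-⊆ t _

  ∣transfer∣ : ∀ A → ∣ transfer s t ∣s∣≡∣t∣ A ∣ ≡ ∣ s ∩ A ∣
  ∣transfer∣ A = begin
    ∣ placeAt t (subst Subset ∣s∣≡∣t∣ (bitsAt s A)) ∣  ≡⟨ ∣placeAt∣ t _ ⟩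
    ∣ subst Subset ∣s∣≡∣t∣ (bitsAt s A) ∣              ≡⟨ ∣subst∣ ∣s∣≡∣t∣ _ ⟩
    ∣ bitsAt s A ∣                                     ≡⟨ ∣placeAt∣ s _ ⟨
    ∣ placeAt s (bitsAt s A) ∣                         ≡⟨ cong ∣_∣ (placeAt-bitsAt s A) ⟩
    ∣ s ∩ A ∣                                          ∎
    where open ≡-Reasoning

  transfer-cong : ∀ {A B} → s ∩ A ≡ s ∩ B → transfer s t ∣s∣≡∣t∣ A ≡ transfer s t ∣s∣≡∣t∣ B
  transfer-cong s∩A≡s∩B = cong (placeAt t ∘ subst Subset ∣s∣≡∣t∣) (bitsAt-cong s s∩A≡s∩B)

  transfer-transfer : ∀ A → transfer t s (sym ∣s∣≡∣t∣) (transfer s t ∣s∣≡∣t∣ A) ≡ s ∩ A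
  transfer-transfer A = begin
    placeAt s (subst Subset (sym ∣s∣≡∣t∣) (bitsAt t (placeAt t (subst Subset ∣s∣≡∣t∣ (bitsAt s A)))))
      ≡⟨ cong (placeAt s ∘ subst Subset (sym ∣s∣≡∣t∣)) (bitsAt-placeAt t _) ⟩
    placeAt s (subst Subset (sym ∣s∣≡∣t∣) (subst Subset ∣s∣≡∣t∣ (bitsAt s A)))
      ≡⟨ cong (placeAt s) (subst-sym-subst ∣s∣≡∣t∣) ⟩
    placeAt s (bitsAt s A)
      ≡⟨ placeAt-bitsAt s A ⟩
    s ∩ A ∎
    where open ≡-Reasoning

exchange : ∀ {n} (X Y : Subset n) → ∣ ∁ X ∩ Y ∣ ≡ ∣ ∁ Y ∩ X ∣ → Subset n → Subset n
exchange X Y balanced A = (X ∩ A) ∪ transfer (∁ X ∩ Y) (∁ Y ∩ X) balanced A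

module _ {n} (X Y : Subset n) (balanced : ∣ ∁ X ∩ Y ∣ ≡ ∣ ∁ Y ∩ X ∣) where

  private
    φ = exchange X Y balanced
    T = transfer (∁ X ∩ Y) (∁ Y ∩ X) balanced

    T⊆∁Y∩X : ∀ A → T A ⊆ ∁ Y ∩ X
    T⊆∁Y∩X = transfer-⊆ (∁ X ∩ Y) (∁ Y ∩ X) balanced

    T⊆∁Y : ∀ A → T A ⊆ ∁ Y
    T⊆∁Y A = ⊆-trans (T⊆∁Y∩X A) (p∩q⊆p (∁ Y) X)

    X∩A⊆Y : ∀ {A} → A ⊆ Y → X ∩ A ⊆ Y
    X∩A⊆Y A⊆Y = ⊆-trans (p∩q⊆q X _) A⊆Y

    ∁X∩Y∩A : ∀ {A} → A ⊆ Y → (∁ X ∩ Y) ∩ A ≡ ∁ X ∩ A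
    ∁X∩Y∩A {A} A⊆Y = trans (∩-assoc (∁ X) Y A) (cong (∁ X ∩_) (p⊆q⇒q∩p≡p A⊆Y))

  exchange-⊆ : ∀ {A} → φ A ⊆ X
  exchange-⊆ {A} = ∪-⊆ (p∩q⊆p X A) (⊆-trans (T⊆∁Y∩X A) (p∩q⊆q (∁ Y) X))

  ∩-exchange : ∀ {C₀ A} → C₀ ⊆ X → C₀ ∩ A ⊆ C₀ ∩ φ A
  ∩-exchange {C₀} {A} C₀⊆X x∈C₀∩A =
    let x∈C₀ , x∈A = x∈p∩q⁻ C₀ A x∈C₀∩A
    in x∈p∩q⁺ (x∈C₀ , p⊆p∪q (T A) (x∈p∩q⁺ (C₀⊆X x∈C₀ , x∈A)))

  ∣exchange∣ : ∀ {A} → A ⊆ Y → ∣ φ A ∣ ≡ ∣ A ∣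
  ∣exchange∣ {A} A⊆Y = begin
    ∣ (X ∩ A) ∪ T A ∣          ≡⟨ ∣∪∣-disjoint _ _ (⊆-∁-disjoint (X∩A⊆Y A⊆Y) (T⊆∁Y A)) ⟩
    ∣ X ∩ A ∣ + ∣ T A ∣        ≡⟨ cong (∣ X ∩ A ∣ +_) ∣T∣ ⟩
    ∣ X ∩ A ∣ + ∣ ∁ X ∩ A ∣    ≡⟨ ∣p∣≡∣q∩p∣+∣∁q∩p∣ A X ⟨
    ∣ A ∣                      ∎
    where
    open ≡-Reasoning
    ∣T∣ : ∣ T A ∣ ≡ ∣ ∁ X ∩ A ∣
    ∣T∣ = trans (∣transfer∣ (∁ X ∩ Y) (∁ Y ∩ X) balanced A) (cong ∣_∣ (∁X∩Y∩A A⊆Y))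

  exchange-exchange : ∀ {A} → A ⊆ Y → exchange Y X (sym balanced) (φ A) ≡ A
  exchange-exchange {A} A⊆Y = begin
    (Y ∩ φ A) ∪ transfer (∁ Y ∩ X) (∁ X ∩ Y) (sym balanced) (φ A)
      ≡⟨ cong₂ _∪_ (p⊆r⇒r∩[p∪q]≡p (X∩A⊆Y A⊆Y) (⊆-∁-disjoint ⊆-refl (T⊆∁Y A)))
                   (transfer-cong (∁ Y ∩ X) (∁ X ∩ Y) (sym balanced) ∁Y∩X∩φA) ⟩
    (X ∩ A) ∪ transfer (∁ Y ∩ X) (∁ X ∩ Y) (sym balanced) (T A)
      ≡⟨ cong ((X ∩ A) ∪_) (trans (transfer-transfer (∁ X ∩ Y) (∁ Y ∩ X) balanced A) (∁X∩Y∩A A⊆Y)) ⟩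
    (X ∩ A) ∪ (∁ X ∩ A)
      ≡⟨ [q∩p]∪[∁q∩p]≡p A X ⟩
    A ∎
    where
    open ≡-Reasoning
    ∁Y∩X∩φA : (∁ Y ∩ X) ∩ φ A ≡ (∁ Y ∩ X) ∩ T A
    ∁Y∩X∩φA = begin
      (∁ Y ∩ X) ∩ ((X ∩ A) ∪ T A)  ≡⟨ cong ((∁ Y ∩ X) ∩_) (∪-comm (X ∩ A) (T A)) ⟩
      (∁ Y ∩ X) ∩ (T A ∪ (X ∩ A))  ≡⟨ p⊆r⇒r∩[p∪q]≡p (T⊆∁Y∩X A) disjoint ⟩
      T A                          ≡⟨ p⊆q⇒q∩p≡p (T⊆∁Y∩X A) ⟨
      (∁ Y ∩ X) ∩ T A              ∎
      where
      disjoint : Empty ((∁ Y ∩ X) ∩ (X ∩ A))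
      disjoint = subst Empty (∩-comm (X ∩ A) (∁ Y ∩ X))
                   (⊆-∁-disjoint (X∩A⊆Y A⊆Y) (p∩q⊆p (∁ Y) X))

  exchange-injective : ∀ {A B} → A ⊆ Y → B ⊆ Y → φ A ≡ φ B → A ≡ B
  exchange-injective A⊆Y B⊆Y φA≡φB =
    trans (sym (exchange-exchange A⊆Y))
          (trans (cong (exchange Y X (sym balanced)) φA≡φB) (exchange-exchange B⊆Y))

  L1-exchange : ∀ {k A} → L1 k Y A → L1 k X (φ A)
  L1-exchange (A⊆Y , ∣A∣≡k) = exchange-⊆ , trans (∣exchange∣ A⊆Y) ∣A∣≡k

  L2bar-exchange : ∀ {k k' K} → L2bar k k' Y K → L2bar k k' X (map φ K)
  L2bar-exchange {K = K} (K⊆L1 , unique , length≡k') =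
    All.map⁺ (All.map L1-exchange K⊆L1) ,
    map-distinct φ (λ (A⊆Y , _) (B⊆Y , _) → exchange-injective A⊆Y B⊆Y) K⊆L1 unique ,
    trans (length-map φ K) length≡k'

  Conflict2-exchange : ∀ {τ' τ K K'} → All (_⊆ X) K → All (_⊆ Y) K' →
                       Conflict2 τ' τ K K' → Conflict2 τ' τ K (map φ K')
  Conflict2-exchange K⊆X K'⊆Y (f , g , f∈K , g∈K' , injective , conflicts) =
    f , φ ∘ g , f∈K , (λ i → ∈-map⁺ φ (g∈K' i)) , injective′ injective ,
    λ i → ≤-trans (conflicts i) (p⊆q⇒∣p∣≤∣q∣ (∩-exchange (All.lookup K⊆X (f∈K i))))
    where
    injective′ : Injective _≡_ _≡_ f ⊎ Injective _≡_ _≡_ g → Injective _≡_ _≡_ f ⊎ Injective _≡_ _≡_ (φ ∘ g)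
    injective′ (inj₁ f-injective) = inj₁ f-injective
    injective′ (inj₂ g-injective) = inj₂ λ {i} {j} φgi≡φgj →
      g-injective (exchange-injective (All.lookup K'⊆Y (g∈K' i)) (All.lookup K'⊆Y (g∈K' j)) φgi≡φgj)

L2-conflicts-bound : ∀ {n k k' τ' τ d₂} (X Y : Subset n) → ∣ X ∣ ≡ ∣ Y ∣ →
                     (K : Coll n) → L2 k k' τ' τ d₂ X K →
                     AtMost _≋_ (λ K' → L2 k k' τ' τ d₂ Y K' × Conflict2 τ' τ K K') d₂
L2-conflicts-bound X Y ∣X∣≡∣Y∣ K ((K⊆L1 , _) , good) =
  atMost-pullback (map φ)
    (λ ((K'∈L̄₂ , _) , conflict) →
       L2bar-exchange X Y balanced K'∈L̄₂ , Conflict2-exchange X Y balanced (⊆X K⊆L1) (⊆Y K'∈L̄₂) conflict)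
    (λ ((K₁∈L̄₂ , _) , _) ((K₂∈L̄₂ , _) , _) →
       map-≋⁻ φ (exchange-injective X Y balanced) (⊆Y K₁∈L̄₂) (⊆Y K₂∈L̄₂))
    (fewerThan⇒atMost good)
  where
  balanced = ∣∁p∩q∣≡∣∁q∩p∣ X Y ∣X∣≡∣Y∣
  φ = exchange X Y balanced
  ⊆X : ∀ {k K} → All (L1 k X) K → All (_⊆ X) K
  ⊆X = All.map proj₁
  ⊆Y : ∀ {k k' K} → L2bar k k' Y K → All (_⊆ Y) K
  ⊆Y (K⊆L1 , _) = All.map proj₁ K⊆L1

lemma4 : (β m n : ℕ) → 1 ≤ β → 1 ≤ m →
         (l₀ τ c τ' k k' d₂ : ℕ) →
         τ' ≡ 2 ^ (τ ∸ c) → k' ≡ β * τ' →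
         τ ≤ k → k ≤ β * τ →
         (X Y : Subset n) → ∣ X ∣ ≡ l₀ → ∣ Y ∣ ≡ l₀ →
         ((C : Subset n) → L1 k X C →
            AtMost _≡_ (λ C' → L1 k Y C' × τConflict τ C C') (d1 l₀ k τ))
         ×
         ((K : Coll n) → L2 k k' τ' τ d₂ X K →
            AtMost _≋_ (λ K' → L2 k k' τ' τ d₂ Y K' × Conflict2 τ' τ K K') d₂)
lemma4 β m n _ _ l₀ τ c τ' k k' d₂ _ _ _ _ X Y ∣X∣≡l₀ ∣Y∣≡l₀ =
  (λ C₀ (_ , ∣C₀∣≡k) → L1-conflicts-bound τ Y C₀ ∣C₀∣≡k ∣Y∣≡l₀) ,
  L2-conflicts-bound X Y (trans ∣X∣≡l₀ (sym ∣Y∣≡l₀))
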